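{- Let $N(n)$ denote God's Number of the $n\times n\times n$ Rubik's Cube, i.e. the smallest $k$ such that every valid configuration can be brought to the solved state by a sequence of at most $k$ basic moves. Then $N(n)=\Omega\!\left(n^2/\log n\right)$ as $n\to\infty$.
   Context: The $n\times n\times n$ Rubik's Cube has six faces, each an $n\times n$ grid of colored stickers; in the solved state each face is monochromatic with six distinct colors. It has $3n$ slices ($n\times n\times 1$ layers parallel to a face, $n$ for each of the three axes, including the central slices when $n$ is odd). A basic move is a $90^\circ$ rotation, clockwise or counterclockwise, of a single slice, giving $6n$ basic moves. A configuration is valid if it can be obtained from the solved state by a sequence of basic moves. -}

module Defs where

open import Data.Nat using (ℕ; zero; suc; _+_; _∸_; _≤_)
open import Data.Fin using (Fin; toℕ; opposite)
open import Data.Product using (_×_; _,_; Σ)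
open import Data.List using (List; []; _∷_; length)
open import Data.Unit using (⊤)
open import Data.Bool using (if_then_else_)
open import Relation.Binary.PropositionalEquality using (_≡_)
open import Relation.Nullary.Decidable using (⌊_⌋)
import Data.Fin as F

-- Signed coordinate values {-1, 0, +1}, used for outward normal vectors.
data Tri : Set where
  neg zer pos : Tri

negT : Tri → Tri
negT neg = pos
negT zer = zer
negT pos = neg

Triple : Set → Set
Triple A = A × A × A

data Axis : Set where
  X Y Z : Axis

-- Proper 90° rotation about the given axis, acting on a triple of
-- coordinates, where 'op' is negation (centered at the cube's center).
-- Each is a rotation matrix of determinant +1.
rot : {A : Set} → (A → A) → Axis → Triple A → Triple A
rot op X (x , y , z) = (x , z , op y)
rot op Y (x , y , z) = (op z , y , x)
rot op Z (x , y , z) = (y , op x , z)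

coord : {A : Set} → Axis → Triple A → A
coord X (x , _ , _) = x
coord Y (_ , y , _) = y
coord Z (_ , _ , z) = z

Pos : ℕ → Set
Pos n = Triple (Fin n)

Dir : Set
Dir = Triple Tri

-- A (potential) sticker: a cubie position together with a direction.
Loc : ℕ → Set
Loc n = Pos n × Dir

-- Colours: a sticker's colour is named by a face normal (six distinct
-- colours in the solved state).
Colour : Set
Colour = Dir

weight : Tri → ℕ
weight zer = 0
weight neg = 1
weight pos = 1

Bdry : (n : ℕ) → Tri → Fin n → Set
Bdry n neg i = toℕ i ≡ 0
Bdry n zer i = ⊤
Bdry n pos i = toℕ i ≡ n ∸ 1

-- (p , d) is an actual sticker: d is a unit axis vector and p lies on
-- the face of the cube with outward normal d.
IsSticker : (n : ℕ) → Loc n → Set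
IsSticker n ((x , y , z) , (a , b , c)) =
  (weight a + weight b + weight c ≡ 1) ×
  Bdry n a x × Bdry n b y × Bdry n c z

-- A configuration assigns a colour to each location; only the values on
-- actual stickers matter (see _≈_).
Config : ℕ → Set
Config n = Loc n → Colour

_≈_ : {n : ℕ} → Config n → Config n → Set
_≈_ {n} c c' = (s : Loc n) → IsSticker n s → c s ≡ c' s

solved : (n : ℕ) → Config n
solved n (p , d) = d

data Turn : Set where
  cw ccw : Turn

-- Basic move: rotate the slice {coordinate along axis = k} by 90°
-- in one of the two directions.  6n basic moves in total.
record Move (n : ℕ) : Set where
  constructor move
  field
    axis  : Axis
    layer : Fin n
    turn  : Turn

rot90 : (n : ℕ) → Axis → Loc n → Loc n
rot90 n a (p , d) = (rot opposite a p , rot negT a d)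

turnLoc : (n : ℕ) → Axis → Turn → Loc n → Loc n
turnLoc n a cw  l = rot90 n a l
turnLoc n a ccw l = rot90 n a (rot90 n a (rot90 n a l))

moveLoc : {n : ℕ} → Move n → Loc n → Loc n
moveLoc {n} (move a k t) (p , d) =
  if ⌊ coord a p F.≟ k ⌋ then turnLoc n a t (p , d) else (p , d)

applyMove : {n : ℕ} → Move n → Config n → Config n
applyMove m c l = c (moveLoc m l)

applyMoves : {n : ℕ} → List (Move n) → Config n → Config n
applyMoves []       c = c
applyMoves (m ∷ ms) c = applyMoves ms (applyMove m c)

Valid : {n : ℕ} → Config n → Set
Valid {n} c = Σ (List (Move n)) λ ms → c ≈ applyMoves ms (solved n)

SolvableWithin : {n : ℕ} → ℕ → Config n → Set
SolvableWithin {n} k c =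
  Σ (List (Move n)) λ ms → (length ms ≤ k) × (applyMoves ms c ≈ solved n)

-- k is an upper bound for God's number N(n); N(n) is the least such k.
GodsBound : ℕ → ℕ → Set
GodsBound n k = (c : Config n) → Valid c → SolvableWithin k c

-- For n = M + 2 and each of the M² interior cells of the top face, the
-- commutator of the x-slice and the y-slice through that cell moves the cell's
-- top sticker to a side face and fixes the corresponding stickers of every
-- other cell.  Applying any subset of these commutators yields 2^(M²) valid
-- configurations, pairwise distinct on the top face.  Moves permute the
-- stickers, so one move sequence solves at most one configuration; as there
-- are at most (6n + 1)^k sequences of length ≤ k, we get 2^(M²) ≤ (6n + 1)^k,
-- i.e. k ≥ M² / log₂ (6n + 1).
module Submission where

open import Defs
open import Data.Empty using (⊥-elim)
open import Data.Fin as Fin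
  using (Fin; zero; suc; opposite; inject₁; combine; remQuot; funToFin; finToFun)
open import Data.Fin.Properties
  using ( opposite-involutive; opposite-prop; fromℕ≢inject₁; suc-injective; inject₁-injective
        ; toℕ-fromℕ; combine-injective; combine-remQuot; funToFin-finToFin; finToFun-funToFin
        ; injective⇒≤ )
open import Data.List using (List; []; _∷_; length; _++_; concatMap; allFin)
open import Data.List.Membership.Propositional using (_∈_)
open import Data.List.Membership.Propositional.Properties using (∈-allFin)
open import Data.List.Relation.Unary.All using (All; []; _∷_)
import Data.List.Relation.Unary.All as All
open import Data.List.Relation.Unary.AllPairs using (_∷_)
open import Data.List.Relation.Unary.Any using (here; there)
open import Data.List.Relation.Unary.Unique.Propositional using (Unique)
open import Data.List.Relation.Unary.Unique.Propositional.Properties using (allFin⁺)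
open import Data.Nat using (ℕ; zero; suc; _+_; _∸_; _*_; _^_; _≤_; _<_; s≤s; z≤n; ⌊_/2⌋)
open import Data.Nat.Induction using (<-rec)
open import Data.Nat.Logarithm
  using (⌊log₂_⌋; ⌊log₂⌋-mono-≤; ⌊log₂[2^n]⌋≡n; ⌊log₂⌊n/2⌋⌋≡⌊log₂n⌋∸1)
open import Data.Nat.Properties
  using ( n∸n≡0; m+[n∸m]≡n; +-identityʳ; *-suc; ^-distribˡ-+-*; ^-*-assoc; ⌊n/2⌋<n; m≤m+n
        ; +-monoˡ-≤; *-monoʳ-≤; *-monoˡ-≤; *-mono-≤; ^-monoˡ-≤; +-commutativeSemigroup
        ; module ≤-Reasoning )
open import Algebra.Properties.CommutativeSemigroup +-commutativeSemigroup
  using (xy∙z≈xz∙y; xy∙z≈zy∙x; xy∙z≈yx∙z)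
open import Data.Nat.Tactic.RingSolver using (solve-∀)
open import Data.Product using (Σ; _×_; _,_; proj₁; proj₂; uncurry)
open import Data.Unit using (tt)
open import Function using (_∘_)
open import Function.Definitions using (Injective)
open import Relation.Binary.PropositionalEquality
open import Relation.Nullary using (Dec; yes; no)

private
  variable
    n : ℕ

-- Moves permute the stickers

movesLoc : List (Move n) → Loc n → Loc n
movesLoc []       l = l
movesLoc (m ∷ ms) l = moveLoc m (movesLoc ms l)

applyMoves-movesLoc : (ms : List (Move n)) (c : Config n) (l : Loc n) →
                      applyMoves ms c l ≡ c (movesLoc ms l)
applyMoves-movesLoc []       c l = refl
applyMoves-movesLoc (m ∷ ms) c l = applyMoves-movesLoc ms (applyMove m c) l

movesLoc-++ : (xs ys : List (Move n)) (l : Loc n) →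
              movesLoc (xs ++ ys) l ≡ movesLoc xs (movesLoc ys l)
movesLoc-++ []       ys l = refl
movesLoc-++ (m ∷ xs) ys l = cong (moveLoc m) (movesLoc-++ xs ys l)

moveLoc-hit : (m : Move n) {p : Pos n} {d : Dir} → coord (Move.axis m) p ≡ Move.layer m →
              moveLoc m (p , d) ≡ turnLoc n (Move.axis m) (Move.turn m) (p , d)
moveLoc-hit (move a k t) {p} eq with coord a p Fin.≟ k
... | yes _ = refl
... | no ne = ⊥-elim (ne eq)

moveLoc-miss : (m : Move n) {p : Pos n} {d : Dir} → coord (Move.axis m) p ≢ Move.layer m →
               moveLoc m (p , d) ≡ (p , d)
moveLoc-miss (move a k t) {p} ne with coord a p Fin.≟ k
... | yes eq = ⊥-elim (ne eq)
... | no _   = refl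

negT-involutive : (t : Tri) → negT (negT t) ≡ t
negT-involutive neg = refl
negT-involutive zer = refl
negT-involutive pos = refl

rot-order4 : {A : Set} (op : A → A) → (∀ x → op (op x) ≡ x) → (a : Axis) (t : Triple A) →
             rot op a (rot op a (rot op a (rot op a t))) ≡ t
rot-order4 op inv X (x , y , z) = cong₂ (λ u v → x , u , v) (inv y) (inv z)
rot-order4 op inv Y (x , y , z) = cong₂ (λ u v → u , y , v) (inv x) (inv z)
rot-order4 op inv Z (x , y , z) = cong₂ (λ u v → u , v , z) (inv x) (inv y)

rot90-order4 : (a : Axis) (l : Loc n) → rot90 n a (rot90 n a (rot90 n a (rot90 n a l))) ≡ l
rot90-order4 a (p , d) =
  cong₂ _,_ (rot-order4 opposite opposite-involutive a p) (rot-order4 negT negT-involutive a d)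

coord-rot : {A : Set} (op : A → A) (a : Axis) (t : Triple A) → coord a (rot op a t) ≡ coord a t
coord-rot op X t = refl
coord-rot op Y t = refl
coord-rot op Z t = refl

coord-turnLoc : (a : Axis) (t : Turn) (l : Loc n) →
                coord a (proj₁ (turnLoc n a t l)) ≡ coord a (proj₁ l)
coord-turnLoc a cw  (p , d) = coord-rot opposite a p
coord-turnLoc a ccw (p , d) =
  trans (coord-rot opposite a _) (trans (coord-rot opposite a _) (coord-rot opposite a p))

invTurn : Turn → Turn
invTurn cw  = ccw
invTurn ccw = cw

invMove : Move n → Move n
invMove (move a k t) = move a k (invTurn t)

turnLoc-invTurn : (a : Axis) (t : Turn) (l : Loc n) → turnLoc n a t (turnLoc n a (invTurn t) l) ≡ l
turnLoc-invTurn a cw  l = rot90-order4 a l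
turnLoc-invTurn a ccw l = rot90-order4 a l

moveLoc-invMove : (m : Move n) (l : Loc n) → moveLoc m (moveLoc (invMove m) l) ≡ l
moveLoc-invMove (move a k t) (p , d) with coord a p Fin.≟ k
... | yes eq = trans (moveLoc-hit (move a k t) (trans (coord-turnLoc a (invTurn t) (p , d)) eq))
                     (turnLoc-invTurn a t (p , d))
... | no ne  = moveLoc-miss (move a k t) ne

movesLoc⁻¹ : List (Move n) → Loc n → Loc n
movesLoc⁻¹ []       l = l
movesLoc⁻¹ (m ∷ ms) l = movesLoc⁻¹ ms (moveLoc (invMove m) l)

movesLoc-movesLoc⁻¹ : (ms : List (Move n)) (l : Loc n) → movesLoc ms (movesLoc⁻¹ ms l) ≡ l
movesLoc-movesLoc⁻¹ []       l = refl
movesLoc-movesLoc⁻¹ (m ∷ ms) l =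
  trans (cong (moveLoc m) (movesLoc-movesLoc⁻¹ ms _)) (moveLoc-invMove m l)

dirWeight : Dir → ℕ
dirWeight (a , b , c) = weight a + weight b + weight c

weight-negT : (t : Tri) → weight (negT t) ≡ weight t
weight-negT neg = refl
weight-negT zer = refl
weight-negT pos = refl

dirWeight-rot : (a : Axis) (d : Dir) → dirWeight (rot negT a d) ≡ dirWeight d
dirWeight-rot X (u , v , w) rewrite weight-negT v = xy∙z≈xz∙y (weight u) (weight w) (weight v)
dirWeight-rot Y (u , v , w) rewrite weight-negT w = xy∙z≈zy∙x (weight w) (weight v) (weight u)
dirWeight-rot Z (u , v , w) rewrite weight-negT u = xy∙z≈yx∙z (weight v) (weight u) (weight w)

Bdry-opposite : (t : Tri) (i : Fin n) → Bdry n t i → Bdry n (negT t) (opposite i)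
Bdry-opposite {n} neg i b = trans (opposite-prop i) (cong (λ v → n ∸ suc v) b)
Bdry-opposite     zer i b = tt
Bdry-opposite {n} pos i b =
  trans (opposite-prop i) (trans (cong (λ v → n ∸ suc v) b) (n∸suc[n∸1]≡0 n))
  where
  n∸suc[n∸1]≡0 : ∀ n → n ∸ suc (n ∸ 1) ≡ 0
  n∸suc[n∸1]≡0 zero    = refl
  n∸suc[n∸1]≡0 (suc n) = n∸n≡0 n

IsSticker-rot90 : (a : Axis) (l : Loc n) → IsSticker n l → IsSticker n (rot90 n a l)
IsSticker-rot90 X ((x , y , z) , d@(u , v , w)) (e , bu , bv , bw) =
  trans (dirWeight-rot X d) e , bu , bw , Bdry-opposite v y bv
IsSticker-rot90 Y ((x , y , z) , d@(u , v , w)) (e , bu , bv , bw) =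
  trans (dirWeight-rot Y d) e , Bdry-opposite w z bw , bv , bu
IsSticker-rot90 Z ((x , y , z) , d@(u , v , w)) (e , bu , bv , bw) =
  trans (dirWeight-rot Z d) e , bv , Bdry-opposite u x bu , bw

IsSticker-moveLoc : (m : Move n) (l : Loc n) → IsSticker n l → IsSticker n (moveLoc m l)
IsSticker-moveLoc (move a k t) (p , d) s with coord a p Fin.≟ k
IsSticker-moveLoc (move a k cw)  l s | yes _ = IsSticker-rot90 a l s
IsSticker-moveLoc (move a k ccw) l s | yes _ =
  IsSticker-rot90 a _ (IsSticker-rot90 a _ (IsSticker-rot90 a l s))
... | no _ = s

IsSticker-movesLoc⁻¹ : (ms : List (Move n)) (l : Loc n) → IsSticker n l →
                       IsSticker n (movesLoc⁻¹ ms l)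
IsSticker-movesLoc⁻¹ []       l s = s
IsSticker-movesLoc⁻¹ (m ∷ ms) l s = IsSticker-movesLoc⁻¹ ms _ (IsSticker-moveLoc (invMove m) l s)

applyMoves-reflects-≈ : (ms : List (Move n)) {c c' : Config n} →
                        applyMoves ms c ≈ applyMoves ms c' → c ≈ c'
applyMoves-reflects-≈ {n} ms {c} {c'} eq s s-sticker = begin
  c s                 ≡⟨ cong c (movesLoc-movesLoc⁻¹ ms s) ⟨
  c (movesLoc ms l)   ≡⟨ applyMoves-movesLoc ms c l ⟨
  applyMoves ms c l   ≡⟨ eq l (IsSticker-movesLoc⁻¹ ms s s-sticker) ⟩
  applyMoves ms c' l  ≡⟨ applyMoves-movesLoc ms c' l ⟩
  c' (movesLoc ms l)  ≡⟨ cong c' (movesLoc-movesLoc⁻¹ ms s) ⟩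
  c' s                ∎
  where
  open ≡-Reasoning
  l : Loc n
  l = movesLoc⁻¹ ms s

solvedBy-same⇒≈ : (ms : List (Move n)) {c c' : Config n} →
                  applyMoves ms c ≈ solved n → applyMoves ms c' ≈ solved n → c ≈ c'
solvedBy-same⇒≈ ms h h' = applyMoves-reflects-≈ ms λ s st → trans (h s st) (sym (h' s st))

movesLoc-fixes-concatMap : {I : Set} (B : I → List (Move n)) {l : Loc n} (qs : List I) →
                           All (λ q → movesLoc (B q) l ≡ l) qs → movesLoc (concatMap B qs) l ≡ l
movesLoc-fixes-concatMap B []       []           = refl
movesLoc-fixes-concatMap B (q ∷ qs) (fix ∷ fixes) =
  trans (movesLoc-++ (B q) _ _) (trans (cong (movesLoc (B q)) (movesLoc-fixes-concatMap B qs fixes)) fix)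

movesLoc-concatMap : {I : Set} (B : I → List (Move n)) {q : I} {qs : List I} {l l' : Loc n} →
                     Unique qs → q ∈ qs → movesLoc (B q) l ≡ l' →
                     (∀ {q'} → q' ≢ q → movesLoc (B q') l ≡ l × movesLoc (B q') l' ≡ l') →
                     movesLoc (concatMap B qs) l ≡ l'
movesLoc-concatMap B {q} {_ ∷ qs} {l} (distinct ∷ _) (here refl) hit fixed =
  trans (movesLoc-++ (B q) _ _) (trans (cong (movesLoc (B q)) others-fix-l) hit)
  where
  others-fix-l : movesLoc (concatMap B qs) l ≡ l
  others-fix-l = movesLoc-fixes-concatMap B qs (All.map (λ q≢q' → proj₁ (fixed (q≢q' ∘ sym))) distinct)
movesLoc-concatMap B {qs = q' ∷ _} (distinct ∷ unique) (there q∈qs) hit fixed =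
  trans (movesLoc-++ (B q') _ _)
        (trans (cong (movesLoc (B q')) (movesLoc-concatMap B unique q∈qs hit fixed))
               (proj₂ (fixed (All.lookup distinct q∈qs))))

-- Counting move sequences

axisTurnCode : Axis → Turn → Fin 6
axisTurnCode X cw  = zero
axisTurnCode X ccw = suc zero
axisTurnCode Y cw  = suc (suc zero)
axisTurnCode Y ccw = suc (suc (suc zero))
axisTurnCode Z cw  = suc (suc (suc (suc zero)))
axisTurnCode Z ccw = suc (suc (suc (suc (suc zero))))

axisTurnOf : Fin 6 → Axis × Turn
axisTurnOf zero                                = X , cw
axisTurnOf (suc zero)                          = X , ccw
axisTurnOf (suc (suc zero))                    = Y , cw
axisTurnOf (suc (suc (suc zero)))              = Y , ccw
axisTurnOf (suc (suc (suc (suc zero))))        = Z , cw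
axisTurnOf (suc (suc (suc (suc (suc zero))))) = Z , ccw

axisTurnOf-axisTurnCode : (a : Axis) (t : Turn) → axisTurnOf (axisTurnCode a t) ≡ (a , t)
axisTurnOf-axisTurnCode X cw  = refl
axisTurnOf-axisTurnCode X ccw = refl
axisTurnOf-axisTurnCode Y cw  = refl
axisTurnOf-axisTurnCode Y ccw = refl
axisTurnOf-axisTurnCode Z cw  = refl
axisTurnOf-axisTurnCode Z ccw = refl

moveCode : Move n → Fin (6 * n)
moveCode (move a k t) = combine (axisTurnCode a t) k

moveCode-injective : Injective _≡_ _≡_ (moveCode {n})
moveCode-injective {n} {move a k t} {move a' k' t'} eq
  with codes , refl ← combine-injective (axisTurnCode a t) k (axisTurnCode a' t') k' eq
  with refl ← trans (sym (axisTurnOf-axisTurnCode a t))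
                    (trans (cong axisTurnOf codes) (axisTurnOf-axisTurnCode a' t'))
  = refl

listCode : {A : Set} {m : ℕ} → (A → Fin m) → (k : ℕ) → List A → Fin k → Fin (suc m)
listCode code (suc k) []       _       = zero
listCode code (suc k) (x ∷ xs) zero    = suc (code x)
listCode code (suc k) (x ∷ xs) (suc i) = listCode code k xs i

listCode-injective : {A : Set} {m : ℕ} {code : A → Fin m} → Injective _≡_ _≡_ code →
                     (k : ℕ) (xs ys : List A) → length xs ≤ k → length ys ≤ k →
                     listCode code k xs ≗ listCode code k ys → xs ≡ ys
listCode-injective inj zero    []       []       _         _         _  = refl
listCode-injective inj (suc k) []       []       _         _         _  = refl
listCode-injective inj (suc k) []       (y ∷ ys) _         _         eq with () ← eq zero
listCode-injective inj (suc k) (x ∷ xs) []       _         _         eq with () ← eq zero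
listCode-injective inj (suc k) (x ∷ xs) (y ∷ ys) (s≤s lxs) (s≤s lys) eq =
  cong₂ _∷_ (inj (suc-injective (eq zero))) (listCode-injective inj k xs ys lxs lys (eq ∘ suc))

funToFin-cong : {m k : ℕ} {f g : Fin m → Fin k} → f ≗ g → funToFin f ≡ funToFin g
funToFin-cong {zero}  eq = refl
funToFin-cong {suc m} eq = cong₂ combine (eq zero) (funToFin-cong (eq ∘ suc))

funToFin-injective : {m k : ℕ} {f g : Fin m → Fin k} → funToFin f ≡ funToFin g → f ≗ g
funToFin-injective {f = f} {g} eq i =
  trans (sym (finToFun-funToFin f i)) (trans (cong (λ c → finToFun c i) eq) (finToFun-funToFin g i))

finToFun-injective : {m k : ℕ} {i j : Fin (k ^ m)} → finToFun i ≗ finToFun j → i ≡ j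
finToFun-injective {m} {k} {i} {j} eq =
  trans (sym (funToFin-finToFin {m} {k} i)) (trans (funToFin-cong {m} {k} eq) (funToFin-finToFin {m} {k} j))

-- A solving sequence of length ≤ k determines the configuration (up to ≈), and
-- such sequences are coded injectively into Fin ((6n + 1)^k).
distinctValid≤ : {p k : ℕ} (config : Fin p → Config n) → (∀ i → Valid (config i)) →
                 (∀ {i j} → config i ≈ config j → i ≡ j) →
                 GodsBound n k → p ≤ suc (6 * n) ^ k
distinctValid≤ {n} {p} {k} config valid distinct godsBound = injective⇒≤ code-injective
  where
  solution : (i : Fin p) → SolvableWithin k (config i)
  solution i = godsBound (config i) (valid i)

  code : Fin p → Fin (suc (6 * n) ^ k)
  code i = funToFin (listCode moveCode k (proj₁ (solution i)))

  code-injective : Injective _≡_ _≡_ code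
  code-injective {i} {j} eq = distinct (solvedBy-same⇒≈ msᵢ msᵢ-solvesᵢ msᵢ-solvesⱼ)
    where
    msᵢ msⱼ : List (Move n)
    msᵢ = proj₁ (solution i)
    msⱼ = proj₁ (solution j)
    msᵢ≡msⱼ : msᵢ ≡ msⱼ
    msᵢ≡msⱼ = listCode-injective moveCode-injective k msᵢ msⱼ
                (proj₁ (proj₂ (solution i))) (proj₁ (proj₂ (solution j))) (funToFin-injective eq)
    msᵢ-solvesᵢ : applyMoves msᵢ (config i) ≈ solved n
    msᵢ-solvesᵢ = proj₂ (proj₂ (solution i))
    msᵢ-solvesⱼ : applyMoves msᵢ (config j) ≈ solved n
    msᵢ-solvesⱼ = subst (λ ms → applyMoves ms (config j) ≈ solved n) (sym msᵢ≡msⱼ)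
                        (proj₂ (proj₂ (solution j)))

-- Commutator patterns on the (M + 2)-cube

module Commutators (M : ℕ) where

  N : ℕ
  N = 2 + M

  top : Fin N
  top = opposite zero

  inner : Fin M → Fin N
  inner a = suc (inject₁ a)

  inner-injective : ∀ {a a'} → inner a ≡ inner a' → a ≡ a'
  inner-injective = inject₁-injective ∘ suc-injective

  inner≢top : ∀ a → top ≢ inner a
  inner≢top a = fromℕ≢inject₁ ∘ suc-injective

  Cell : Set
  Cell = Fin M × Fin M

  -- onZ⁺ c is the top sticker of cell c; the others are where the slice turns carry it.
  onZ⁺ onY⁺ onX⁺ onY⁻ : Cell → Loc N
  onZ⁺ (a , b) = (inner a , inner b , top) , (zer , zer , pos)
  onY⁺ (a , b) = (inner a , top , opposite (inner b)) , (zer , pos , zer)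
  onX⁺ (a , b) = (top , inner b , opposite (inner a)) , (pos , zer , zer)
  onY⁻ (a , b) = (inner a , zero , inner b) , (zer , neg , zer)

  sliceX sliceY : Fin M → Turn → Move N
  sliceX a = move X (inner a)
  sliceY b = move Y (inner b)

  commutator : Cell → List (Move N)
  commutator (a , b) = sliceX a cw ∷ sliceY b cw ∷ sliceX a ccw ∷ sliceY b ccw ∷ []

  -- The trace l, l₁, l₂, l₃, l' of a location; the last move of the list acts first.
  movesLoc-commutator : ∀ c l l₁ l₂ l₃ l' →
    moveLoc (sliceY (proj₂ c) ccw) l ≡ l₁ → moveLoc (sliceX (proj₁ c) ccw) l₁ ≡ l₂ →
    moveLoc (sliceY (proj₂ c) cw) l₂ ≡ l₃ → moveLoc (sliceX (proj₁ c) cw) l₃ ≡ l' →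
    movesLoc (commutator c) l ≡ l'
  movesLoc-commutator c l l₁ l₂ l₃ l' refl refl refl step = step

  sliceY-ccw-onZ⁺ : ∀ a b → moveLoc (sliceY b ccw) (onZ⁺ (a , b)) ≡ onX⁺ (a , b)
  sliceY-ccw-onZ⁺ a b =
    trans (moveLoc-hit (sliceY b ccw) refl)
          (cong (λ x → (x , inner b , opposite (inner a)) , (pos , zer , zer)) (opposite-involutive top))

  sliceY-cw-onX⁺ : ∀ a b → moveLoc (sliceY b cw) (onX⁺ (a , b)) ≡ onZ⁺ (a , b)
  sliceY-cw-onX⁺ a b =
    trans (moveLoc-hit (sliceY b cw) refl)
          (cong (λ x → (x , inner b , top) , (zer , zer , pos)) (opposite-involutive (inner a)))

  sliceX-cw-onZ⁺ : ∀ a b → moveLoc (sliceX a cw) (onZ⁺ (a , b)) ≡ onY⁺ (a , b)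
  sliceX-cw-onZ⁺ a b = moveLoc-hit (sliceX a cw) refl

  sliceX-ccw-onZ⁺ : ∀ a b → moveLoc (sliceX a ccw) (onZ⁺ (a , b)) ≡ onY⁻ (a , b)
  sliceX-ccw-onZ⁺ a b =
    trans (moveLoc-hit (sliceX a ccw) refl)
          (cong₂ (λ y z → (inner a , y , z) , (zer , neg , zer))
                 (opposite-involutive zero) (opposite-involutive (inner b)))

  sliceX-cw-onY⁻ : ∀ a b → moveLoc (sliceX a cw) (onY⁻ (a , b)) ≡ onZ⁺ (a , b)
  sliceX-cw-onY⁻ a b = moveLoc-hit (sliceX a cw) refl

  sliceX-ccw-onY⁺ : ∀ a b → moveLoc (sliceX a ccw) (onY⁺ (a , b)) ≡ onZ⁺ (a , b)
  sliceX-ccw-onY⁺ a b =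
    trans (moveLoc-hit (sliceX a ccw) refl)
          (cong₂ (λ y z → (inner a , y , z) , (zer , zer , pos))
                 (opposite-involutive (inner b)) (opposite-involutive top))

  commutator-onZ⁺ : ∀ c → movesLoc (commutator c) (onZ⁺ c) ≡ onY⁺ c
  commutator-onZ⁺ c@(a , b) = movesLoc-commutator c (onZ⁺ c) (onX⁺ c) (onX⁺ c) (onZ⁺ c) (onY⁺ c)
    (sliceY-ccw-onZ⁺ a b) (moveLoc-miss (sliceX a ccw) (inner≢top a))
    (sliceY-cw-onX⁺ a b) (sliceX-cw-onZ⁺ a b)

  commutator-fixes-onZ⁺ : ∀ c c' → c ≢ c' → movesLoc (commutator c') (onZ⁺ c) ≡ onZ⁺ c
  commutator-fixes-onZ⁺ c@(a , b) (a' , b') = cases (b Fin.≟ b') (a Fin.≟ a')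
    where
    cases : ∀ {a' b'} → Dec (b ≡ b') → Dec (a ≡ a') → c ≢ (a' , b') →
            movesLoc (commutator (a' , b')) (onZ⁺ c) ≡ onZ⁺ c
    cases (yes refl) (yes refl) c≢c' = ⊥-elim (c≢c' refl)
    cases {a'} {b'} (yes refl) (no a≢a') _ =
      movesLoc-commutator (a' , b') (onZ⁺ c) (onX⁺ c) (onX⁺ c) (onZ⁺ c) (onZ⁺ c)
        (sliceY-ccw-onZ⁺ a b) (moveLoc-miss (sliceX a' ccw) (inner≢top a'))
        (sliceY-cw-onX⁺ a b) (moveLoc-miss (sliceX a' cw) (a≢a' ∘ inner-injective))
    cases {a'} {b'} (no b≢b') (yes refl) _ =
      movesLoc-commutator (a' , b') (onZ⁺ c) (onZ⁺ c) (onY⁻ c) (onY⁻ c) (onZ⁺ c)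
        (moveLoc-miss (sliceY b' ccw) (b≢b' ∘ inner-injective)) (sliceX-ccw-onZ⁺ a b)
        (moveLoc-miss (sliceY b' cw) λ ()) (sliceX-cw-onY⁻ a b)
    cases {a'} {b'} (no b≢b') (no a≢a') _ =
      movesLoc-commutator (a' , b') (onZ⁺ c) (onZ⁺ c) (onZ⁺ c) (onZ⁺ c) (onZ⁺ c)
        (moveLoc-miss (sliceY b' ccw) (b≢b' ∘ inner-injective))
        (moveLoc-miss (sliceX a' ccw) (a≢a' ∘ inner-injective))
        (moveLoc-miss (sliceY b' cw) (b≢b' ∘ inner-injective))
        (moveLoc-miss (sliceX a' cw) (a≢a' ∘ inner-injective))

  commutator-fixes-onY⁺ : ∀ c c' → c ≢ c' → movesLoc (commutator c') (onY⁺ c) ≡ onY⁺ c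
  commutator-fixes-onY⁺ c@(a , b) (a' , b') = cases (b Fin.≟ b') (a Fin.≟ a')
    where
    cases : ∀ {a' b'} → Dec (b ≡ b') → Dec (a ≡ a') → c ≢ (a' , b') →
            movesLoc (commutator (a' , b')) (onY⁺ c) ≡ onY⁺ c
    cases (yes refl) (yes refl) c≢c' = ⊥-elim (c≢c' refl)
    cases {a'} {b'} _ (no a≢a') _ =
      movesLoc-commutator (a' , b') (onY⁺ c) (onY⁺ c) (onY⁺ c) (onY⁺ c) (onY⁺ c)
        (moveLoc-miss (sliceY b' ccw) (inner≢top b'))
        (moveLoc-miss (sliceX a' ccw) (a≢a' ∘ inner-injective))
        (moveLoc-miss (sliceY b' cw) (inner≢top b'))
        (moveLoc-miss (sliceX a' cw) (a≢a' ∘ inner-injective))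
    cases {a'} {b'} (no b≢b') (yes refl) _ =
      movesLoc-commutator (a' , b') (onY⁺ c) (onY⁺ c) (onZ⁺ c) (onZ⁺ c) (onY⁺ c)
        (moveLoc-miss (sliceY b' ccw) (inner≢top b')) (sliceX-ccw-onY⁺ a b)
        (moveLoc-miss (sliceY b' cw) (b≢b' ∘ inner-injective)) (sliceX-cw-onZ⁺ a b)

  onZ⁺-IsSticker : ∀ c → IsSticker N (onZ⁺ c)
  onZ⁺-IsSticker c = refl , tt , tt , toℕ-fromℕ (suc M)

  cell : Fin (M * M) → Cell
  cell = remQuot M

  cell-injective : ∀ {q q'} → cell q ≡ cell q' → q ≡ q'
  cell-injective {q} {q'} eq =
    trans (sym (combine-remQuot {M} M q)) (trans (cong (uncurry combine) eq) (combine-remQuot {M} M q'))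

  Pattern : Set
  Pattern = Fin (M * M) → Fin 2

  commutatorIf : Fin 2 → Fin (M * M) → List (Move N)
  commutatorIf zero    q = []
  commutatorIf (suc _) q = commutator (cell q)

  patternMoves : Pattern → List (Move N)
  patternMoves f = concatMap (λ q → commutatorIf (f q) q) (allFin (M * M))

  patterned : Pattern → Config N
  patterned f = applyMoves (patternMoves f) (solved N)

  readout : Fin 2 → Fin (M * M) → Loc N
  readout zero    q = onZ⁺ (cell q)
  readout (suc _) q = onY⁺ (cell q)

  commutatorIf-onZ⁺ : ∀ b q → movesLoc (commutatorIf b q) (onZ⁺ (cell q)) ≡ readout b q
  commutatorIf-onZ⁺ zero    q = refl
  commutatorIf-onZ⁺ (suc _) q = commutator-onZ⁺ (cell q)

  commutatorIf-fixes-readout : ∀ b b' q q' → q' ≢ q →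
                               movesLoc (commutatorIf b' q') (readout b q) ≡ readout b q
  commutatorIf-fixes-readout b       zero    q q' q'≢q = refl
  commutatorIf-fixes-readout zero    (suc _) q q' q'≢q =
    commutator-fixes-onZ⁺ (cell q) (cell q') (q'≢q ∘ sym ∘ cell-injective)
  commutatorIf-fixes-readout (suc _) (suc _) q q' q'≢q =
    commutator-fixes-onY⁺ (cell q) (cell q') (q'≢q ∘ sym ∘ cell-injective)

  patternMoves-onZ⁺ : ∀ f q → movesLoc (patternMoves f) (onZ⁺ (cell q)) ≡ readout (f q) q
  patternMoves-onZ⁺ f q =
    movesLoc-concatMap (λ q' → commutatorIf (f q') q') (allFin⁺ (M * M)) (∈-allFin q)
      (commutatorIf-onZ⁺ (f q) q)
      (λ {q'} q'≢q → commutatorIf-fixes-readout zero  (f q') q q' q'≢q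
                   , commutatorIf-fixes-readout (f q) (f q') q q' q'≢q)

  readout-injective : ∀ b b' q → proj₂ (readout b q) ≡ proj₂ (readout b' q) → b ≡ b'
  readout-injective zero       zero       q eq = refl
  readout-injective (suc zero) (suc zero) q eq = refl
  readout-injective zero       (suc zero) q ()
  readout-injective (suc zero) zero       q ()

  patterned-injective : ∀ {f g} → patterned f ≈ patterned g → f ≗ g
  patterned-injective {f} {g} eq q = readout-injective (f q) (g q) q (begin
    proj₂ (readout (f q) q)                     ≡⟨ cong proj₂ (patternMoves-onZ⁺ f q) ⟨
    solved N (movesLoc (patternMoves f) s)      ≡⟨ applyMoves-movesLoc (patternMoves f) (solved N) s ⟨
    patterned f s                               ≡⟨ eq s (onZ⁺-IsSticker (cell q)) ⟩
    patterned g s                               ≡⟨ applyMoves-movesLoc (patternMoves g) (solved N) s ⟩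
    solved N (movesLoc (patternMoves g) s)      ≡⟨ cong proj₂ (patternMoves-onZ⁺ g q) ⟩
    proj₂ (readout (g q) q)                     ∎)
    where
    open ≡-Reasoning
    s : Loc N
    s = onZ⁺ (cell q)

  2^[M*M]≤[1+6N]^k : ∀ {k} → GodsBound N k → 2 ^ (M * M) ≤ suc (6 * N) ^ k
  2^[M*M]≤[1+6N]^k =
    distinctValid≤ (patterned ∘ finToFun) (λ i → patternMoves (finToFun i) , λ _ _ → refl)
                   (finToFun-injective ∘ patterned-injective)

n<2^[1+⌊log₂n⌋] : ∀ n → n < 2 ^ suc ⌊log₂ n ⌋
n<2^[1+⌊log₂n⌋] = <-rec (λ n → n < 2 ^ suc ⌊log₂ n ⌋) step
  where
  step : ∀ n → (∀ {m} → m < n → m < 2 ^ suc ⌊log₂ m ⌋) → n < 2 ^ suc ⌊log₂ n ⌋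
  step zero            _  = s≤s z≤n
  step (suc zero)      _  = s≤s (s≤s z≤n)
  step n@(suc (suc m)) ih = begin
    suc n                        ≤⟨ suc≤2*suc⌊/2⌋ n ⟩
    2 * suc ⌊ n /2⌋              ≤⟨ *-monoʳ-≤ 2 (ih (⌊n/2⌋<n (suc m))) ⟩
    2 * 2 ^ suc ⌊log₂ ⌊ n /2⌋ ⌋  ≡⟨ cong (λ e → 2 * 2 ^ suc e) (⌊log₂⌊n/2⌋⌋≡⌊log₂n⌋∸1 n) ⟩
    2 * 2 ^ suc (⌊log₂ n ⌋ ∸ 1)  ≡⟨ cong (λ e → 2 * 2 ^ e) (m+[n∸m]≡n {1} 1≤⌊log₂n⌋) ⟩
    2 ^ suc ⌊log₂ n ⌋            ∎
    where
    open ≤-Reasoning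
    1≤⌊log₂n⌋ : 1 ≤ ⌊log₂ n ⌋
    1≤⌊log₂n⌋ =
      subst (_≤ ⌊log₂ n ⌋) (⌊log₂[2^n]⌋≡n 1) (⌊log₂⌋-mono-≤ {2} {n} (s≤s (s≤s z≤n)))
    suc≤2*suc⌊/2⌋ : ∀ n → suc n ≤ 2 * suc ⌊ n /2⌋
    suc≤2*suc⌊/2⌋ zero          = s≤s z≤n
    suc≤2*suc⌊/2⌋ (suc zero)    = s≤s (s≤s z≤n)
    suc≤2*suc⌊/2⌋ (suc (suc n)) =
      subst (3 + n ≤_) (sym (*-suc 2 (suc ⌊ n /2⌋))) (s≤s (s≤s (suc≤2*suc⌊/2⌋ n)))

2^-reflects-≤ : ∀ {m n} → 2 ^ m ≤ 2 ^ n → m ≤ n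
2^-reflects-≤ {m} {n} le = subst₂ _≤_ (⌊log₂[2^n]⌋≡n m) (⌊log₂[2^n]⌋≡n n) (⌊log₂⌋-mono-≤ le)

1+6n≤2^[4+⌊log₂n⌋] : ∀ n → suc (6 * n) ≤ 2 ^ (4 + ⌊log₂ n ⌋)
1+6n≤2^[4+⌊log₂n⌋] n = begin
  suc (6 * n)                ≤⟨ m≤m+n (suc (6 * n)) (7 + 2 * n) ⟩
  suc (6 * n) + (7 + 2 * n)  ≡⟨ [1+6n]+[7+2n]≡8*[1+n] n ⟩
  8 * suc n                  ≤⟨ *-monoʳ-≤ 8 (n<2^[1+⌊log₂n⌋] n) ⟩
  8 * 2 ^ suc ⌊log₂ n ⌋      ≡⟨ ^-distribˡ-+-* 2 3 (suc ⌊log₂ n ⌋) ⟨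
  2 ^ (4 + ⌊log₂ n ⌋)        ∎
  where
  open ≤-Reasoning
  [1+6n]+[7+2n]≡8*[1+n] : ∀ n → suc (6 * n) + (7 + 2 * n) ≡ 8 * suc n
  [1+6n]+[7+2n]≡8*[1+n] = solve-∀

[2+M]²≤12*[k*⌊log₂[2+M]⌋] : ∀ M k → 2 ≤ M → M * M ≤ (4 + ⌊log₂ (2 + M) ⌋) * k →
                            (2 + M) * (2 + M) ≤ 12 * (k * ⌊log₂ (2 + M) ⌋)
[2+M]²≤12*[k*⌊log₂[2+M]⌋] M k 2≤M M*M≤ = begin
  (2 + M) * (2 + M)   ≤⟨ *-mono-≤ 2+M≤2*M 2+M≤2*M ⟩
  (2 * M) * (2 * M)   ≡⟨ [2*M]*[2*M]≡4*[M*M] M ⟩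
  4 * (M * M)         ≤⟨ *-monoʳ-≤ 4 M*M≤ ⟩
  4 * ((4 + L) * k)   ≤⟨ *-monoʳ-≤ 4 (*-monoˡ-≤ k 4+L≤3*L) ⟩
  4 * (3 * L * k)     ≡⟨ 4*[3*L*k]≡12*[k*L] L k ⟩
  12 * (k * L)        ∎
  where
  open ≤-Reasoning
  L : ℕ
  L = ⌊log₂ (2 + M) ⌋
  [2*M]*[2*M]≡4*[M*M] : ∀ M → (2 * M) * (2 * M) ≡ 4 * (M * M)
  [2*M]*[2*M]≡4*[M*M] = solve-∀
  4*[3*L*k]≡12*[k*L] : ∀ L k → 4 * (3 * L * k) ≡ 12 * (k * L)
  4*[3*L*k]≡12*[k*L] = solve-∀
  2*L+L≡3*L : ∀ L → 2 * L + L ≡ 3 * L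
  2*L+L≡3*L = solve-∀
  2+M≤2*M : 2 + M ≤ 2 * M
  2+M≤2*M = subst (2 + M ≤_) (cong (M +_) (sym (+-identityʳ M))) (+-monoˡ-≤ M 2≤M)
  2≤L : 2 ≤ L
  2≤L = subst (_≤ L) (⌊log₂[2^n]⌋≡n 2) (⌊log₂⌋-mono-≤ {4} {2 + M} (s≤s (s≤s 2≤M)))
  4+L≤3*L : 4 + L ≤ 3 * L
  4+L≤3*L = subst (4 + L ≤_) (2*L+L≡3*L L) (+-monoˡ-≤ L (*-monoʳ-≤ 2 2≤L))

M*M≤[4+⌊log₂[2+M]⌋]*k : ∀ M k → GodsBound (2 + M) k → M * M ≤ (4 + ⌊log₂ (2 + M) ⌋) * k
M*M≤[4+⌊log₂[2+M]⌋]*k M k godsBound = 2^-reflects-≤ (begin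
  2 ^ (M * M)                      ≤⟨ Commutators.2^[M*M]≤[1+6N]^k M godsBound ⟩
  suc (6 * (2 + M)) ^ k            ≤⟨ ^-monoˡ-≤ k (1+6n≤2^[4+⌊log₂n⌋] (2 + M)) ⟩
  (2 ^ (4 + ⌊log₂ (2 + M) ⌋)) ^ k  ≡⟨ ^-*-assoc 2 (4 + ⌊log₂ (2 + M) ⌋) k ⟩
  2 ^ ((4 + ⌊log₂ (2 + M) ⌋) * k)  ∎)
  where open ≤-Reasoning

theorem20 : Σ ℕ λ C → Σ ℕ λ n₀ → (n : ℕ) → n₀ ≤ n → (k : ℕ) →
    GodsBound n k → n * n ≤ C * (k * ⌊log₂ n ⌋)
theorem20 = 12 , 4 , λ where
  (suc (suc M)) (s≤s (s≤s 2≤M)) k godsBound →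
    [2+M]²≤12*[k*⌊log₂[2+M]⌋] M k 2≤M (M*M≤[4+⌊log₂[2+M]⌋]*k M k godsBound)
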